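{- Consider the game $W_1$. For each integer $y \ge 0$ and each integer $g \ge 0$, let $x_g(y)$ denote the unique $x \ge 0$ such that $(x,y)$ has nim-value $g$. Then: (i) $x_g(0) = x_0(0) + g$ for all $g \ge 0$; (ii) $x_g(1) = x_0(1) + g$ if and only if $g$ is even; (iii) $x_g(2) = x_0(2) + g$ if and only if $g \equiv 0 \pmod 4$; (iv) $x_g(3) \ne x_0(3) + g$ for every positive integer $g \equiv 0 \pmod 4$.
   Context: Positions are pairs $(x,y)$ of nonnegative integers. The impartial game $W_1$ (normal play: last player able to move wins) allows from $(a,b)$: a Nim move to $(a-s,b)$ or $(a,b-s)$ for any integer $s>0$ keeping coordinates nonnegative; and a diagonal move to $(a-s,b-s)$ with $s>0$, allowed only if $\min(a-s,b-s) \ge 1$. The nim-value (Sprague–Grundy value) of a position is the minimum excluded nonnegative integer of the set of nim-values of positions reachable in one move (terminal positions have nim-value $0$). Since horizontal Nim moves are allowed, each row $\{(x,y): x \ge 0\}$ contains exactly one position of each nim-value $g$. -}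

module Defs where

open import Data.Nat using (ℕ; _+_; _<_; _≤_)
open import Data.Product using (_×_; _,_; ∃)
open import Relation.Binary.PropositionalEquality using (_≡_; _≢_)

Pos : Set
Pos = ℕ × ℕ

data Move : Pos → Pos → Set where
  nimˣ : ∀ {x y s} → 1 ≤ s → Move (x + s , y) (x , y)
  nimʸ : ∀ {x y s} → 1 ≤ s → Move (x , y + s) (x , y)
  diag : ∀ {x y s} → 1 ≤ s → 1 ≤ x → 1 ≤ y → Move (x + s , y + s) (x , y)

IsNimValue : (Pos → ℕ) → Set
IsNimValue f =
  ∀ p → ((∀ q → Move p q → f q ≢ f p) ×
         (∀ k → k < f p → ∃ λ q → Move p q × f q ≡ k))

module Submission where

open import Defs
open import Data.Nat using (ℕ; _+_; _<_)
open import Data.Nat.Divisibility using (_∣_)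
open import Data.Product using (_×_; _,_)
open import Function.Bundles using (_⇔_)
open import Relation.Binary.PropositionalEquality using (_≡_; _≢_)

open import Data.Bool using (Bool; true; T; not; _∨_)
open import Data.Bool.Properties using (T-∨)
open import Data.Bool.ListAction using (all; any)
open import Data.Empty using (⊥-elim)
open import Data.List using (List; []; _∷_; _++_; length)
open import Data.List.Membership.Propositional using (_∈_; find)
open import Data.List.Membership.Propositional.Properties using (∈-++⁺ˡ; ∈-++⁺ʳ; ∈-++⁻)
open import Data.List.Relation.Unary.All as All using ()
open import Data.List.Relation.Unary.All.Properties using (all⁺)
open import Data.List.Relation.Unary.Any using (here; there)
open import Data.List.Relation.Unary.Any.Properties using (any⁻)
open import Data.Nat using (zero; suc; _≤_; _%_; _≡ᵇ_; _<ᵇ_; z≤n; s≤s; z<s)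
open import Data.Nat.Divisibility using (m%n≡0⇔n∣m; n∣m⇒m%n≡0)
open import Data.Nat.Induction using (<-rec; <-wellFounded)
open import Data.Nat.Properties
open import Data.Product using (∃; proj₁; proj₂; uncurry)
open import Data.Sum using (_⊎_; inj₁; inj₂)
open import Function using (_∘_; _on_)
open import Function.Bundles using (Equivalence; mk⇔)
open import Function.Properties.Equivalence using () renaming (refl to ⇔-refl; trans to ⇔-trans)
open import Induction.WellFounded using (Acc; acc)
open import Relation.Binary.Construct.On using (wellFounded)
open import Relation.Binary.Definitions using (tri<; tri≈; tri>)
open import Relation.Binary.PropositionalEquality using (refl; sym; trans; cong; subst; subst₂; module ≡-Reasoning)
open import Relation.Nullary using (yes; no)
open import Relation.Nullary.Decidable using (True; toWitness; T?; _×-dec_; _→-dec_; ¬?)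
open import Relation.Unary using (Decidable)

-- Moves never raise the row y, so the nim-values of rows 0–3 only depend on
-- rows 0–3.  On these rows they are given by explicit tables `row y`, with
-- inverses `rowInv y` (so x_g(y) = rowInv y g): after a finite prefix each table
-- advances by 4 every 4 steps.

block : ℕ → ℕ → ℕ → ℕ → ℕ → ℕ
block a b c d 0 = a
block a b c d 1 = b
block a b c d 2 = c
block a b c d 3 = d
block a b c d (suc (suc (suc (suc x)))) = 4 + block a b c d x

extend : List ℕ → (ℕ → ℕ) → ℕ → ℕ
extend [] tail x = tail x
extend (v ∷ t) tail zero = v
extend (v ∷ t) tail (suc x) = extend t tail x

extend-shift : ∀ t a b c d x → length t ≤ x →
  extend t (block a b c d) (4 + x) ≡ 4 + extend t (block a b c d) x
extend-shift [] a b c d x _ = refl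
extend-shift (v ∷ t) a b c d (suc x) (s≤s t≤x) = extend-shift t a b c d x t≤x

prefix₃ : List ℕ
prefix₃ = 3 ∷ 2 ∷ 0 ∷ 4 ∷ 1 ∷ 8 ∷ 9 ∷ 10 ∷ 5 ∷ 7 ∷
          6 ∷ 12 ∷ 15 ∷ 11 ∷ 16 ∷ 17 ∷ 13 ∷ 20 ∷ 14 ∷ 21 ∷ []

inversePrefix₃ : List ℕ
inversePrefix₃ = 2 ∷ 4 ∷ 1 ∷ 0 ∷ 3 ∷ 8 ∷ 10 ∷ 9 ∷ 5 ∷ 6 ∷ 7 ∷
                 13 ∷ 11 ∷ 16 ∷ 18 ∷ 12 ∷ 14 ∷ 15 ∷ 20 ∷ 21 ∷ 17 ∷ 19 ∷ []

row : ℕ → ℕ → ℕ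
row 0 x = x
row 1 x = block 1 0 3 2 x
row 2 x = block 2 3 1 0 x
row 3 x = extend prefix₃ (block 18 19 24 25) x
row (suc (suc (suc (suc _)))) _ = 0

rowInv : ℕ → ℕ → ℕ
rowInv 0 g = g
rowInv 1 g = block 1 0 3 2 g
rowInv 2 g = block 3 2 0 1 g
rowInv 3 g = extend inversePrefix₃ (block 24 25 22 23) g
rowInv (suc (suc (suc (suc _)))) _ = 0

nim : Pos → ℕ
nim (x , y) = row y x

periodicInduction : (P : ℕ → Set) (N : ℕ) → (∀ {x} → x < N + 4 → P x) →
  (∀ z → P (N + z) → P (4 + (N + z))) → ∀ x → P x
periodicInduction P N base step = <-rec P induct
  where
  induct : ∀ x → (∀ {y} → y < x → P y) → P x
  induct x smaller with x <? N + 4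
  ... | yes x<N+4 = base x<N+4
  ... | no x≮N+4 with m≤n⇒∃[o]m+o≡n (≮⇒≥ x≮N+4)
  ... | z , refl = subst P reorder (step z (smaller (subst (N + z <_) reorder (m<n+m (N + z) {4} z<s))))
    where
    reorder : 4 + (N + z) ≡ N + 4 + z
    reorder = cong (_+ z) (+-comm 4 N)

byPeriodicity : {P : ℕ → Set} (P? : Decidable P) → True (allUpTo? P? 28) →
  (∀ z → P (24 + z) → P (4 + (24 + z))) → ∀ x → P x
byPeriodicity {P} P? checked = periodicInduction P 24 (toWitness checked)

-- A value k
-- whose G-position lies left of x is always covered; values k below K + 4 are of
-- this kind from x = N + 4 on, and larger ones shift along with x.
periodicCover : (F G : ℕ → ℕ) (Q : ℕ → ℕ → Set) (N K : ℕ) →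
  (∀ {x k} → G k < x → Q x k) →
  (∀ {k} → k < K + 4 → G k < N + 4) →
  (∀ {x} → x < N + 4 → ∀ {k} → k < F x → Q x k) →
  (∀ z → F (4 + (N + z)) ≡ 4 + F (N + z)) →
  (∀ z w → Q (N + z) (K + w) → Q (4 + (N + z)) (4 + (K + w))) →
  ∀ x {k} → k < F x → Q x k
periodicCover F G Q N K horizontal small base shift step =
  periodicInduction (λ x → ∀ {k} → k < F x → Q x k) N base coverStep
  where
  coverStep : ∀ z → (∀ {k} → k < F (N + z) → Q (N + z) k) →
              ∀ {k} → k < F (4 + (N + z)) → Q (4 + (N + z)) k
  coverStep z covered {k} k<F with k <? K + 4
  ... | yes k<K+4 = horizontal (<-≤-trans (small k<K+4)
                      (subst (_≤ 4 + (N + z)) (+-comm 4 N) (+-monoʳ-≤ 4 (m≤m+n N z))))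
  ... | no k≮K+4 with m≤n⇒∃[o]m+o≡n (≮⇒≥ k≮K+4)
  ... | w , refl = subst (Q (4 + (N + z))) (cong (_+ w) (+-comm 4 K))
                     (step z w (covered (+-cancelˡ-< 4 (K + w) (F (N + z))
                       (subst₂ _<_ (cong (_+ w) (+-comm K 4)) (shift z) k<F))))

size : Pos → ℕ
size (x , y) = x + y

move-size : ∀ {p q} → Move p q → size q < size p
move-size (nimˣ {x} {y} {s} 1≤s) = +-monoˡ-< y (m<m+n x 1≤s)
move-size (nimʸ {x} {y} {s} 1≤s) = +-monoʳ-< x (m<m+n y 1≤s)
move-size (diag {x} {y} {s} 1≤s _ _) = +-mono-< (m<m+n x 1≤s) (m<m+n y 1≤s)

move-row : ∀ {p q} → Move p q → proj₂ q ≤ proj₂ p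
move-row (nimˣ _) = ≤-refl
move-row (nimʸ {y = y} {s} _) = m≤m+n y s
move-row (diag {y = y} {s} _ _ _) = m≤m+n y s

column : ℕ → ℕ → List Pos
column x zero = []
column x (suc y) = (x , y) ∷ column x y

diagonal : ℕ → ℕ → List Pos
diagonal (suc (suc x)) (suc (suc y)) = (suc x , suc y) ∷ diagonal (suc x) (suc y)
diagonal _ _ = []

lowerOptions : Pos → List Pos
lowerOptions (x , y) = column x y ++ diagonal x y

column-∋ : ∀ x y s → (x , y) ∈ column x (suc (s + y))
column-∋ x y zero = here refl
column-∋ x y (suc s) = there (column-∋ x y s)

diagonal-∋ : ∀ x y s → (suc x , suc y) ∈ diagonal (suc s + suc x) (suc s + suc y)
diagonal-∋ x y zero = here refl
diagonal-∋ x y (suc s) = there (diagonal-∋ x y s)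

move-cases : ∀ {p q} → Move p q →
  (∃ λ x' → x' < proj₁ p × q ≡ (x' , proj₂ p)) ⊎ q ∈ lowerOptions p
move-cases (nimˣ {x} {y} {s} 1≤s) = inj₁ (x , m<m+n x 1≤s , refl)
move-cases (nimʸ {x} {y} {suc s} _) =
  inj₂ (∈-++⁺ˡ (subst (λ t → (x , y) ∈ column x t) (sym (+-comm y (suc s))) (column-∋ x y s)))
move-cases (diag {suc x} {suc y} {suc s} _ _ _) =
  inj₂ (∈-++⁺ʳ (column (suc x + suc s) (suc y + suc s))
    (subst₂ (λ a b → (suc x , suc y) ∈ diagonal a b)
      (sym (+-comm (suc x) (suc s))) (sym (+-comm (suc y) (suc s))) (diagonal-∋ x y s)))

+-suc-swap : ∀ m n → m + suc n ≡ n + suc m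
+-suc-swap m n = trans (+-comm m (suc n)) (sym (+-suc n m))

-- Conversely, the lower options are reached by moves; the lemmas are stated for
-- positions raised by s so that the induction along the list goes through.
column-move : ∀ {x y q} s → q ∈ column x y → Move (x , s + y) q
column-move {x} {suc y} s (here refl) =
  subst (λ t → Move (x , t) (x , y)) (+-suc-swap y s) (nimʸ (s≤s z≤n))
column-move {x} {suc y} {q} s (there q∈) =
  subst (λ t → Move (x , t) q) (sym (+-suc s y)) (column-move (suc s) q∈)

diagonal-move : ∀ {x y q} s → q ∈ diagonal x y → Move (s + x , s + y) q
diagonal-move {suc (suc x)} {suc (suc y)} s (here refl) =
  subst₂ (λ a b → Move (a , b) (suc x , suc y)) (+-suc-swap (suc x) s) (+-suc-swap (suc y) s)
    (diag (s≤s z≤n) (s≤s z≤n) (s≤s z≤n))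
diagonal-move {suc (suc x)} {suc (suc y)} {q} s (there q∈) =
  subst₂ (λ a b → Move (a , b) q) (sym (+-suc s (suc x))) (sym (+-suc s (suc y)))
    (diagonal-move (suc s) q∈)
diagonal-move {zero} s ()
diagonal-move {suc zero} s ()
diagonal-move {suc (suc x)} {zero} s ()
diagonal-move {suc (suc x)} {suc zero} s ()

lower-move : ∀ {p q} → q ∈ lowerOptions p → Move p q
lower-move {x , y} q∈ with ∈-++⁻ (column x y) q∈
... | inj₁ q∈column = column-move 0 q∈column
... | inj₂ q∈diagonal = diagonal-move 0 q∈diagonal

horizontal-move : ∀ {x' x y} → x' < x → Move (x , y) (x' , y)
horizontal-move {x'} {x} {y} x'<x =
  subst (λ t → Move (t , y) (x' , y)) (m+[n∸m]≡n (<⇒≤ x'<x)) (nimˣ (m<n⇒0<n∸m x'<x))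

Mex : (Pos → ℕ) → Pos → Set
Mex v p = (∀ q → Move p q → v q ≢ v p) × (∀ k → k < v p → ∃ λ q → Move p q × v q ≡ k)

mex-unique : ∀ {f v p} → Mex f p → Mex v p → (∀ q → Move p q → f q ≡ v q) → f p ≡ v p
mex-unique {f} {v} {p} (f-avoids , f-covers) (v-avoids , v-covers) agree with <-cmp (f p) (v p)
... | tri≈ _ fp≡vp _ = fp≡vp
... | tri< fp<vp _ _ = let (q , m , vq≡fp) = v-covers (f p) fp<vp in
                       ⊥-elim (f-avoids q m (trans (agree q m) vq≡fp))
... | tri> _ _ vp<fp = let (q , m , fq≡vp) = f-covers (v p) vp<fp in
                       ⊥-elim (v-avoids q m (trans (sym (agree q m)) fq≡vp))

nimValues-agree : ∀ {f v} → IsNimValue f → (R : Pos → Set) →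
  (∀ {p q} → Move p q → R p → R q) → (∀ {p} → R p → Mex v p) → ∀ p → R p → f p ≡ v p
nimValues-agree {f} {v} isNim R closed mex p = induct p (wellFounded size <-wellFounded p)
  where
  induct : ∀ p → Acc (_<_ on size) p → R p → f p ≡ v p
  induct p (acc smaller) Rp =
    mex-unique (isNim p) (mex Rp) (λ q m → induct q (smaller (move-size m)) (closed m Rp))

-- From x = 24 on, row 3 and its inverse stay beyond their prefixes, so that
-- `extend-shift` applies to the composites of the two tables.
row₃-large : ∀ x → 24 ≤ x → 22 ≤ row 3 x
row₃-large = byPeriodicity (λ x → 24 ≤? x →-dec 22 ≤? row 3 x) _
  (λ z bound _ → ≤-trans (bound (m≤m+n 24 z)) (m≤n+m _ 4))

rowInv₃-large : ∀ g → 24 ≤ g → 20 ≤ rowInv 3 g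
rowInv₃-large = byPeriodicity (λ g → 24 ≤? g →-dec 20 ≤? rowInv 3 g) _
  (λ z bound _ → ≤-trans (bound (m≤m+n 24 z)) (m≤n+m _ 4))

rowInv-row : ∀ {y} → y ≤ 3 → ∀ x → rowInv y (row y x) ≡ x
rowInv-row {0} _ x = refl
rowInv-row {1} _ = byPeriodicity (λ x → rowInv 1 (row 1 x) ≟ x) _ (λ _ → cong (4 +_))
rowInv-row {2} _ = byPeriodicity (λ x → rowInv 2 (row 2 x) ≟ x) _ (λ _ → cong (4 +_))
rowInv-row {3} _ = byPeriodicity (λ x → rowInv 3 (row 3 x) ≟ x) _ step
  where
  open ≡-Reasoning
  step : ∀ z → rowInv 3 (row 3 (24 + z)) ≡ 24 + z → rowInv 3 (row 3 (4 + (24 + z))) ≡ 4 + (24 + z)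
  step z ih = begin
    rowInv 3 (4 + row 3 (24 + z))
      ≡⟨ extend-shift inversePrefix₃ 24 25 22 23 (row 3 (24 + z))
           (≤-trans (s≤s (s≤s ≤-refl)) (row₃-large (24 + z) (m≤m+n 24 z))) ⟩
    4 + rowInv 3 (row 3 (24 + z))
      ≡⟨ cong (4 +_) ih ⟩
    4 + (24 + z) ∎
rowInv-row {suc (suc (suc (suc _)))} (s≤s (s≤s (s≤s ())))

row-rowInv : ∀ {y} → y ≤ 3 → ∀ g → row y (rowInv y g) ≡ g
row-rowInv {0} _ g = refl
row-rowInv {1} _ = byPeriodicity (λ g → row 1 (rowInv 1 g) ≟ g) _ (λ _ → cong (4 +_))
row-rowInv {2} _ = byPeriodicity (λ g → row 2 (rowInv 2 g) ≟ g) _ (λ _ → cong (4 +_))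
row-rowInv {3} _ = byPeriodicity (λ g → row 3 (rowInv 3 g) ≟ g) _ step
  where
  open ≡-Reasoning
  step : ∀ z → row 3 (rowInv 3 (24 + z)) ≡ 24 + z → row 3 (rowInv 3 (4 + (24 + z))) ≡ 4 + (24 + z)
  step z ih = begin
    row 3 (4 + rowInv 3 (24 + z))
      ≡⟨ extend-shift prefix₃ 18 19 24 25 (rowInv 3 (24 + z))
           (rowInv₃-large (24 + z) (m≤m+n 24 z)) ⟩
    4 + row 3 (rowInv 3 (24 + z))
      ≡⟨ cong (4 +_) ih ⟩
    4 + (24 + z) ∎
row-rowInv {suc (suc (suc (suc _)))} (s≤s (s≤s (s≤s ())))

row-injective : ∀ {y a b} → y ≤ 3 → row y a ≡ row y b → a ≡ b
row-injective {y} {a} {b} y≤3 e = begin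
  a                   ≡⟨ sym (rowInv-row y≤3 a) ⟩
  rowInv y (row y a)  ≡⟨ cong (rowInv y) e ⟩
  rowInv y (row y b)  ≡⟨ rowInv-row y≤3 b ⟩
  b                   ∎
  where open ≡-Reasoning

excludes : ℕ → ℕ → Bool
excludes y x = all (λ q → not (nim q ≡ᵇ row y x)) (lowerOptions (x , y))

covers : ℕ → ℕ → ℕ → Bool
covers y x k = any (λ q → nim q ≡ᵇ k) (lowerOptions (x , y)) ∨ (rowInv y k <ᵇ x)

row-excludes : ∀ {y} → y ≤ 3 → ∀ x → T (excludes y x)
row-excludes {0} _ = byPeriodicity (T? ∘ excludes 0) _ (λ _ h → h)
row-excludes {1} _ = byPeriodicity (T? ∘ excludes 1) _ (λ _ h → h)
row-excludes {2} _ = byPeriodicity (T? ∘ excludes 2) _ (λ _ h → h)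
row-excludes {3} _ = byPeriodicity (T? ∘ excludes 3) _ (λ _ h → h)
row-excludes {suc (suc (suc (suc _)))} (s≤s (s≤s (s≤s ())))

coverByPeriodicity : ∀ y →
  True (allUpTo? (λ k → rowInv y k <? 28) 26) →
  True (allUpTo? (λ x → allUpTo? (λ k → T? (covers y x k)) (row y x)) 28) →
  (∀ z → row y (4 + (24 + z)) ≡ 4 + row y (24 + z)) →
  (∀ z w → T (covers y (24 + z) (22 + w)) → T (covers y (4 + (24 + z)) (4 + (22 + w)))) →
  ∀ x {k} → k < row y x → T (covers y x k)
coverByPeriodicity y small base =
  periodicCover (row y) (rowInv y) (λ x k → T (covers y x k)) 24 22
    (λ left → Equivalence.from T-∨ (inj₂ (<⇒<ᵇ left))) (toWitness small) (toWitness base)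

row-covers : ∀ {y} → y ≤ 3 → ∀ x {k} → k < row y x → T (covers y x k)
row-covers {0} _ = coverByPeriodicity 0 _ _ (λ _ → refl) (λ _ _ h → h)
row-covers {1} _ = coverByPeriodicity 1 _ _ (λ _ → refl) (λ _ _ h → h)
row-covers {2} _ = coverByPeriodicity 2 _ _ (λ _ → refl) (λ _ _ h → h)
row-covers {3} _ = coverByPeriodicity 3 _ _ (λ _ → refl) (λ _ _ h → h)
row-covers {suc (suc (suc (suc _)))} (s≤s (s≤s (s≤s ())))

≢-by-test : ∀ {m n} → T (not (m ≡ᵇ n)) → m ≢ n
≢-by-test {m} {n} test m≡n with m ≡ᵇ n | ≡⇒≡ᵇ m n m≡n
... | true | _ = test

nim-mex : ∀ {p} → proj₂ p ≤ 3 → Mex nim p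
nim-mex {x , y} y≤3 = avoids , reaches
  where
  avoids : ∀ q → Move (x , y) q → nim q ≢ row y x
  avoids q m with move-cases m
  ... | inj₁ (x' , x'<x , refl) = λ e → <-irrefl (row-injective y≤3 e) x'<x
  ... | inj₂ q∈ = ≢-by-test (All.lookup (all⁺ _ (lowerOptions (x , y)) (row-excludes y≤3 x)) q∈)

  reaches : ∀ k → k < row y x → ∃ λ q → Move (x , y) q × nim q ≡ k
  reaches k k<v with Equivalence.to T-∨ (row-covers y≤3 x k<v)
  ... | inj₁ lower = let (q , q∈ , test) = find (any⁻ _ (lowerOptions (x , y)) lower) in
                     q , lower-move q∈ , ≡ᵇ⇒≡ (nim q) k test
  ... | inj₂ left = (rowInv y k , y) , horizontal-move (<ᵇ⇒< _ x left) , row-rowInv y≤3 k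

nimValue-rows : ∀ {f} → IsNimValue f → ∀ {x y} → y ≤ 3 → f (x , y) ≡ row y x
nimValue-rows isNim {x} {y} =
  nimValues-agree isNim (λ p → proj₂ p ≤ 3) (λ m → ≤-trans (move-row m)) nim-mex (x , y)

position : ∀ {f} → IsNimValue f → ∀ {x y g} → y ≤ 3 → f (x , y) ≡ g → x ≡ rowInv y g
position isNim {x} {y} {g} y≤3 fx≡g = begin
  x                   ≡⟨ sym (rowInv-row y≤3 x) ⟩
  rowInv y (row y x)  ≡⟨ cong (rowInv y) (trans (sym (nimValue-rows isNim y≤3)) fx≡g) ⟩
  rowInv y g          ∎
  where open ≡-Reasoning

relativePosition : ∀ {f} → IsNimValue f → ∀ {y g x₀ x} → y ≤ 3 →
  f (x₀ , y) ≡ 0 → f (x , y) ≡ g → (x ≡ x₀ + g ⇔ rowInv y g ≡ rowInv y 0 + g)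
relativePosition isNim y≤3 f₀ f₁
  with refl ← position isNim y≤3 f₀ | refl ← position isNim y≤3 f₁ = ⇔-refl

shifted : ∀ {a b} {C : Set} → (a ≡ b → C) × (C → a ≡ b) → (4 + a ≡ 4 + b → C) × (C → 4 + a ≡ 4 + b)
shifted (to , from) = (λ e → to (+-cancelˡ-≡ 4 _ _ e)) , (λ c → cong (4 +_) (from c))

row₁-displacement : ∀ g → rowInv 1 g ≡ 1 + g ⇔ 2 ∣ g
row₁-displacement g = ⇔-trans (uncurry mk⇔ (periodic g)) (m%n≡0⇔n∣m g 2)
  where
  periodic : ∀ g → (rowInv 1 g ≡ 1 + g → g % 2 ≡ 0) × (g % 2 ≡ 0 → rowInv 1 g ≡ 1 + g)
  periodic = byPeriodicity
    (λ g → (rowInv 1 g ≟ 1 + g →-dec g % 2 ≟ 0) ×-dec (g % 2 ≟ 0 →-dec rowInv 1 g ≟ 1 + g))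
    _ (λ _ → shifted)

row₂-displacement : ∀ g → rowInv 2 g ≡ 3 + g ⇔ 4 ∣ g
row₂-displacement g = ⇔-trans (uncurry mk⇔ (periodic g)) (m%n≡0⇔n∣m g 4)
  where
  periodic : ∀ g → (rowInv 2 g ≡ 3 + g → g % 4 ≡ 0) × (g % 4 ≡ 0 → rowInv 2 g ≡ 3 + g)
  periodic = byPeriodicity
    (λ g → (rowInv 2 g ≟ 3 + g →-dec g % 4 ≟ 0) ×-dec (g % 4 ≟ 0 →-dec rowInv 2 g ≟ 3 + g))
    _ (λ _ → shifted)

row₃-displacement : ∀ g → 0 < g → 4 ∣ g → rowInv 3 g ≢ 2 + g
row₃-displacement g 0<g 4∣g = periodic g (n∣m⇒m%n≡0 g 4 4∣g) 0<g
  where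
  periodic : ∀ g → g % 4 ≡ 0 → 0 < g → rowInv 3 g ≢ 2 + g
  periodic = byPeriodicity
    (λ g → g % 4 ≟ 0 →-dec 0 <? g →-dec ¬? (rowInv 3 g ≟ 2 + g))
    _ (λ _ claim divisible _ e → claim divisible z<s (+-cancelˡ-≡ 4 _ _ e))

lemma6 : (f : Pos → ℕ) → IsNimValue f →
    (∀ g x₀ x → f (x₀ , 0) ≡ 0 → f (x , 0) ≡ g → x ≡ x₀ + g) ×
    (∀ g x₀ x → f (x₀ , 1) ≡ 0 → f (x , 1) ≡ g → (x ≡ x₀ + g ⇔ 2 ∣ g)) ×
    (∀ g x₀ x → f (x₀ , 2) ≡ 0 → f (x , 2) ≡ g → (x ≡ x₀ + g ⇔ 4 ∣ g)) ×
    (∀ g x₀ x → 0 < g → 4 ∣ g → f (x₀ , 3) ≡ 0 → f (x , 3) ≡ g → x ≢ x₀ + g)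
lemma6 f isNim =
  (λ g x₀ x f₀ f₁ → Equivalence.from (relativePosition isNim z≤n f₀ f₁) refl) ,
  (λ g x₀ x f₀ f₁ →
     ⇔-trans (relativePosition isNim (s≤s z≤n) f₀ f₁) (row₁-displacement g)) ,
  (λ g x₀ x f₀ f₁ →
     ⇔-trans (relativePosition isNim (s≤s (s≤s z≤n)) f₀ f₁) (row₂-displacement g)) ,
  (λ g x₀ x 0<g 4∣g f₀ f₁ →
     row₃-displacement g 0<g 4∣g ∘ Equivalence.to (relativePosition isNim ≤-refl f₀ f₁))
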